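{- Let $a,b,r$ be real numbers and define the sequence $(U^{a,b,r}_{n})$ by $U^{a,b,r}_{0}=b-r\,a$, $U^{a,b,r}_{1}=a$ and $U^{a,b,r}_{n+2}=r\,U^{a,b,r}_{n+1}+U^{a,b,r}_{n}$ for $n\ge 0$, extended to $n=-1$ by $U^{a,b,r}_{ -1}=U^{a,b,r}_{1}-r\,U^{a,b,r}_{0}=a-r(b-ra)$. Then for every nonnegative integer $m$ and every real $c\neq 0$, \[ c^{m+1}\,U^{a,b,r}_{m+1}=b-r\,a+\sum_{i=0}^{m} c^{i}\left\{(r-1)\,U^{a,b,r}_{i}+(c-1)\,U^{a,b,r}_{i+1}+U^{a,b,r}_{i-1}\right\}. \]
   Context: The sequence $U^{a,b,r}_n$ is a generalized second-order sequence unifying generalized Fibonacci ($r=1$) and generalized Pell ($r=2$) numbers. The term $U^{a,b,r}_{ -1}$ appearing for $i=0$ is defined by running the recurrence $U^{a,b,r}_{n+1}=r\,U^{a,b,r}_{n}+U^{a,b,r}_{n-1}$ backward at $n=0$. -}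

module Defs where

open import Level using (Level)
open import Data.Nat using (ℕ; zero; suc)
open import Algebra.Bundles using (CommutativeRing)

module Seq {c ℓ : Level} (R : CommutativeRing c ℓ) where
  open CommutativeRing R hiding (zero)

  pow : Carrier → ℕ → Carrier
  pow x zero    = 1#
  pow x (suc n) = x * pow x n

  U : Carrier → Carrier → Carrier → ℕ → Carrier
  U a b r zero          = b - r * a
  U a b r (suc zero)    = a
  U a b r (suc (suc n)) = r * U a b r (suc n) + U a b r n

  -- Uprev a b r i = U^{a,b,r}_{i-1}, with U_{-1} = U_1 - r U_0 = a - r (b - r a)
  Uprev : Carrier → Carrier → Carrier → ℕ → Carrier
  Uprev a b r zero    = a - r * (b - r * a)
  Uprev a b r (suc i) = U a b r i

  sumTo : ℕ → (ℕ → Carrier) → Carrier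
  sumTo zero    f = f zero
  sumTo (suc m) f = sumTo m f + f (suc m)

-- The bracket collapses to c U_{i+1} − U_i, because U_{i+1} = r U_i + U_{i-1} holds for every
-- i ≥ 0 (at i = 0 this is how U_{-1} is chosen). So the i-th summand is
-- c^{i+1} U_{i+1} − c^i U_i, the sum telescopes to c^{m+1} U_{m+1} − U_0, and U_0 = b − r a.
{-# OPTIONS --safe #-}
module Submission where

open import Defs
open import Level using (Level)
open import Data.Nat using (ℕ; suc; zero)
open import Algebra.Bundles using (CommutativeRing)
open import Relation.Nullary using (¬_)
import Algebra.Properties.CommutativeSemigroup as CommutativeSemigroupProperties
import Algebra.Properties.Group as GroupProperties
import Algebra.Solver.Ring.NaturalCoefficients.Default as NaturalCoefficientsSolver
import Relation.Binary.Reasoning.Setoid as SetoidReasoning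

module _ {c ℓ : Level} (R : CommutativeRing c ℓ) where
  open CommutativeRing R hiding (zero)
  open Seq R
  open SetoidReasoning setoid
  open NaturalCoefficientsSolver commutativeSemiring
  open GroupProperties +-group using (//-rightDividesˡ)
  open CommutativeSemigroupProperties +-commutativeSemigroup using (xy∙z≈xz∙y)

  sumTo-telescope : ∀ m (f g : ℕ → Carrier) → (∀ i → g i + f i ≈ f (suc i)) →
                    sumTo m g + f zero ≈ f (suc m)
  sumTo-telescope zero    f g step = step zero
  sumTo-telescope (suc m) f g step = begin
    (sumTo m g + g (suc m)) + f zero ≈⟨ xy∙z≈xz∙y (sumTo m g) (g (suc m)) (f zero) ⟩
    (sumTo m g + f zero) + g (suc m) ≈⟨ +-congʳ (sumTo-telescope m f g step) ⟩
    f (suc m) + g (suc m)            ≈⟨ +-comm (f (suc m)) (g (suc m)) ⟩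
    g (suc m) + f (suc m)            ≈⟨ step (suc m) ⟩
    f (suc (suc m))                  ∎

  U-recurrence : ∀ a b r i → U a b r (suc i) ≈ r * U a b r i + Uprev a b r i
  U-recurrence a b r zero    = begin
    a           ≈⟨ //-rightDividesˡ u a ⟨
    (a - u) + u ≈⟨ +-comm (a - u) u ⟩
    u + (a - u) ∎
    where u = r * (b - r * a)
  U-recurrence a b r (suc i) = refl

  bracket-collapse : ∀ r k {x y p} → y ≈ r * x + p →
                     (((r - 1#) * x + (k - 1#) * y) + p) + x ≈ k * y
  bracket-collapse r k {x} {y} {p} y≈rx+p = begin
    (((r - 1#) * x + (k - 1#) * y) + p) + x
      ≈⟨ solve 5 (λ s t x y p → ((s :* x :+ t :* y) :+ p) :+ x
                                := ((s :+ con 1) :* x :+ p) :+ t :* y) refl (r - 1#) (k - 1#) x y p ⟩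
    (((r - 1#) + 1#) * x + p) + (k - 1#) * y
      ≈⟨ +-congʳ (+-congʳ (*-congʳ (//-rightDividesˡ 1# r))) ⟩
    (r * x + p) + (k - 1#) * y
      ≈⟨ +-congʳ y≈rx+p ⟨
    y + (k - 1#) * y
      ≈⟨ solve 2 (λ t y → y :+ t :* y := (t :+ con 1) :* y) refl (k - 1#) y ⟩
    ((k - 1#) + 1#) * y
      ≈⟨ *-congʳ (//-rightDividesˡ 1# k) ⟩
    k * y ∎

  summand-plus-weighted-U : ∀ a b r k i →
    pow k i * (((r - 1#) * U a b r i + (k - 1#) * U a b r (suc i)) + Uprev a b r i)
      + pow k i * U a b r i
      ≈ pow k (suc i) * U a b r (suc i)
  summand-plus-weighted-U a b r k i = begin
    pow k i * B + pow k i * U a b r i ≈⟨ distribˡ (pow k i) B (U a b r i) ⟨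
    pow k i * (B + U a b r i)         ≈⟨ *-congˡ (bracket-collapse r k (U-recurrence a b r i)) ⟩
    pow k i * (k * U a b r (suc i))   ≈⟨ solve 3 (λ p k y → p :* (k :* y) := k :* p :* y)
                                               refl (pow k i) k (U a b r (suc i)) ⟩
    k * pow k i * U a b r (suc i)     ∎
    where B = ((r - 1#) * U a b r i + (k - 1#) * U a b r (suc i)) + Uprev a b r i

theorem1 : ∀ {c ℓ : Level} (R : CommutativeRing c ℓ) → let open CommutativeRing R in let open Seq R in
    ∀ (a b r : Carrier) (m : ℕ) (k : Carrier) → ¬ (k ≈ 0#) →
      pow k (suc m) * U a b r (suc m)
        ≈ (b - r * a) + sumTo m (λ i → pow k i * (((r - 1#) * U a b r i + (k - 1#) * U a b r (suc i)) + Uprev a b r i))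
theorem1 R a b r m k _ = begin
  F (suc m)                     ≈⟨ sumTo-telescope R m F summand (summand-plus-weighted-U R a b r k) ⟨
  sumTo m summand + F zero      ≈⟨ +-comm (sumTo m summand) (F zero) ⟩
  F zero + sumTo m summand      ≈⟨ +-congʳ (*-identityˡ (U a b r zero)) ⟩
  U a b r zero + sumTo m summand ∎
  where
  open CommutativeRing R hiding (zero)
  open Seq R
  open SetoidReasoning setoid
  F : ℕ → Carrier
  F i = pow k i * U a b r i
  summand : ℕ → Carrier
  summand i = pow k i * (((r - 1#) * U a b r i + (k - 1#) * U a b r (suc i)) + Uprev a b r i)
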